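{- Let $n\geq 2$. Let $F_1$ be a set of singletons $\{x\}$ with $x\in V(BH_n)$ and let $F_2$ be a set of pairs $\{x_1,x_2\}$ with $x_1x_2\in E(BH_n)$. If $|F_1|+|F_2|\leq 2n-1$, then $BH_n-V(F_1\cup F_2)$ is connected.
   Context: The $n$-dimensional balanced hypercube $BH_n$ is the graph with vertex set $\{0,1,2,3\}^n$, vertices written $(a_0,a_1,\dots,a_{n-1})$, in which $(a_0,\dots,a_{n-1})$ is adjacent exactly to the $2n$ vertices $((a_0\pm 1)\bmod 4,a_1,\dots,a_{n-1})$ and, for each $1\le i\le n-1$, $((a_0\pm1)\bmod 4,a_1,\dots,a_{i-1},(a_i+(-1)^{a_0})\bmod 4,a_{i+1},\dots,a_{n-1})$. $V(F_1\cup F_2)$ denotes the union of all the sets in $F_1\cup F_2$. -}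

module Defs where

open import Data.Nat using (ℕ)
open import Data.Fin using (Fin; zero; suc)
open import Data.Vec using (Vec; _∷_; _[_]%=_)
open import Data.List using (List)
open import Data.List.Membership.Propositional using (_∈_)
open import Data.List.Relation.Unary.Any using (Any)
open import Data.Product using (_×_; proj₁; proj₂; Σ)
open import Data.Sum using (_⊎_)
open import Relation.Binary.PropositionalEquality using (_≡_)
open import Relation.Nullary using (¬_)

Vertex : ℕ → Set
Vertex n = Vec (Fin 4) n

inc4 : Fin 4 → Fin 4
inc4 zero = suc zero
inc4 (suc zero) = suc (suc zero)
inc4 (suc (suc zero)) = suc (suc (suc zero))
inc4 (suc (suc (suc zero))) = zero

dec4 : Fin 4 → Fin 4
dec4 zero = suc (suc (suc zero))
dec4 (suc zero) = zero
dec4 (suc (suc zero)) = suc zero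
dec4 (suc (suc (suc zero))) = suc (suc zero)

-- x ↦ (x + (-1)^a) mod 4
shift : (a : Fin 4) → Fin 4 → Fin 4
shift zero = inc4
shift (suc zero) = dec4
shift (suc (suc zero)) = inc4
shift (suc (suc (suc zero))) = dec4

data PlusMinus1 (a : Fin 4) : Fin 4 → Set where
  plus  : PlusMinus1 a (inc4 a)
  minus : PlusMinus1 a (dec4 a)

-- adjacency in BH_n; the first coordinate is a_0, the tail is (a_1,...,a_{n-1})
data Adj : {n : ℕ} → Vertex n → Vertex n → Set where
  outer : ∀ {m} {a b : Fin 4} {as : Vec (Fin 4) m} →
          PlusMinus1 a b → Adj (a ∷ as) (b ∷ as)
  inner : ∀ {m} {a b : Fin 4} {as : Vec (Fin 4) m} (i : Fin m) →
          PlusMinus1 a b → Adj (a ∷ as) (b ∷ (as [ i ]%= shift a))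

-- an edge x1 x2 of BH_n, representing the pair {x1, x2}
Edge : ℕ → Set
Edge n = Σ (Vertex n × Vertex n) (λ p → Adj (proj₁ p) (proj₂ p))

InFaults : ∀ {n} → List (Vertex n) → List (Edge n) → Vertex n → Set
InFaults F1 F2 v = v ∈ F1 ⊎ Any (λ e → v ≡ proj₁ (proj₁ e) ⊎ v ≡ proj₂ (proj₁ e)) F2

data Walk {n : ℕ} (P : Vertex n → Set) : Vertex n → Vertex n → Set where
  here : ∀ {u} → P u → Walk P u u
  step : ∀ {u w v} → P u → Adj u w → Walk P w v → Walk P u v

Connected : ∀ {n} → (Vertex n → Set) → Set
Connected {n} P = Σ (Vertex n) P × (∀ u v → P u → P v → Walk P u v)

Remaining : ∀ {n} → List (Vertex n) → List (Edge n) → Vertex n → Set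
Remaining F1 F2 v = ¬ InFaults F1 F2 v

module Submission where

-- Everything rests on the covering bound: covered vertices that are pairwise
-- distinct and non-adjacent need distinct faults.  It is used through a gadget
-- lemma (with few faults, some position of a gadget keeps a near and a far
-- survivor) and directly in the base case.
-- Base case n = 2: the twin classes {(a, c), (a + 2, c)} of BH_2 form an
-- 8-cycle of completely joined neighbours; three faults kill at most two
-- consecutive classes, and the remaining six carry all survivors.
-- Step n − 1 → n: the layers a_1 = c are copies of BH_{n−1}.  By counting, at
-- most one layer β is overloaded (≥ 2(n−1) induced faults), possibly after the
-- automorphism swapping a_1 and a_2; the other layers are connected by
-- induction, gadgets give bridges between consecutive layers and an escape
-- from β.

open import Defs
open import Data.Bool using (Bool; true; false; not; if_then_else_)
import Data.Bool.Properties as BoolP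
open import Data.Empty using (⊥; ⊥-elim)
open import Data.Fin using (Fin; zero; suc; toℕ; #_)
import Data.Fin.Properties as FinP
open import Data.List using (List; []; _∷_; _++_; length; map; concatMap; filter; tabulate)
import Data.List.Properties as ListP
open import Data.List.Membership.Propositional using (_∈_)
open import Data.List.Membership.Propositional.Properties using (∈-tabulate⁻)
open import Data.List.Relation.Unary.All as All using (All; []; _∷_)
open import Data.List.Relation.Unary.AllPairs using (AllPairs; []; _∷_)
import Data.List.Relation.Unary.All.Properties as AllP
import Data.List.Relation.Unary.AllPairs.Properties as AllPairsP
open import Data.List.Relation.Unary.Any as Any using (Any; here; there; any?)
import Data.List.Relation.Unary.Any.Properties as AnyP
open import Data.List.Relation.Unary.Unique.Propositional using (Unique)
import Data.List.Relation.Unary.Unique.Propositional.Properties as UniqueP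
open import Data.Nat using (ℕ; zero; suc; _≤_; _<_; _+_; _*_; _∸_; z≤n; s≤s; _≤?_)
open import Data.Nat.Properties
open import Data.Nat.Tactic.RingSolver using (solve-∀)
open import Data.Product using (_×_; _,_; proj₁; proj₂; Σ)
open import Data.Sum using (_⊎_; inj₁; inj₂; [_,_]′)
open import Data.Vec using (Vec; []; _∷_; _[_]%=_; lookup; replicate)
import Data.Vec.Properties as VecP
open import Function using (_∘_; id; _∋_)
open import Relation.Binary.PropositionalEquality
open import Relation.Nullary using (¬_; Dec; yes; no; ¬?)
open import Relation.Nullary.Decidable using (toWitness; map′; _×-dec_; _⊎-dec_; _→-dec_)

pattern 0₄ = zero
pattern 1₄ = suc zero
pattern 2₄ = suc (suc zero)
pattern 3₄ = suc (suc (suc zero))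

dec∘inc : ∀ x → dec4 (inc4 x) ≡ x
dec∘inc 0₄ = refl
dec∘inc 1₄ = refl
dec∘inc 2₄ = refl
dec∘inc 3₄ = refl

inc∘dec : ∀ x → inc4 (dec4 x) ≡ x
inc∘dec 0₄ = refl
inc∘dec 1₄ = refl
inc∘dec 2₄ = refl
inc∘dec 3₄ = refl

dec∘dec : ∀ x → dec4 (dec4 x) ≡ inc4 (inc4 x)
dec∘dec 0₄ = refl
dec∘dec 1₄ = refl
dec∘dec 2₄ = refl
dec∘dec 3₄ = refl

inc≢id : ∀ x → inc4 x ≢ x
inc≢id 0₄ ()
inc≢id 1₄ ()
inc≢id 2₄ ()
inc≢id 3₄ ()

inc²≢id : ∀ x → inc4 (inc4 x) ≢ x
inc²≢id 0₄ ()
inc²≢id 1₄ ()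
inc²≢id 2₄ ()
inc²≢id 3₄ ()

inc³≢id : ∀ x → inc4 (inc4 (inc4 x)) ≢ x
inc³≢id 0₄ ()
inc³≢id 1₄ ()
inc³≢id 2₄ ()
inc³≢id 3₄ ()

dec≢id : ∀ x → dec4 x ≢ x
dec≢id 0₄ ()
dec≢id 1₄ ()
dec≢id 2₄ ()
dec≢id 3₄ ()

inc≢dec : ∀ x → inc4 x ≢ dec4 x
inc≢dec 0₄ ()
inc≢dec 1₄ ()
inc≢dec 2₄ ()
inc≢dec 3₄ ()

even : Fin 4 → Bool
even 0₄ = true
even 1₄ = false
even 2₄ = true
even 3₄ = false

even-inc : ∀ a → even (inc4 a) ≡ not (even a)
even-inc 0₄ = refl
even-inc 1₄ = refl
even-inc 2₄ = refl
even-inc 3₄ = refl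

even-dec : ∀ a → even (dec4 a) ≡ not (even a)
even-dec 0₄ = refl
even-dec 1₄ = refl
even-dec 2₄ = refl
even-dec 3₄ = refl

even-inc² : ∀ a → even (inc4 (inc4 a)) ≡ even a
even-inc² 0₄ = refl
even-inc² 1₄ = refl
even-inc² 2₄ = refl
even-inc² 3₄ = refl

shift-by-parity : ∀ a → shift a ≡ (if even a then inc4 else dec4)
shift-by-parity 0₄ = refl
shift-by-parity 1₄ = refl
shift-by-parity 2₄ = refl
shift-by-parity 3₄ = refl

shift-parity : ∀ {a b} → even a ≡ even b → ∀ x → shift a x ≡ shift b x
shift-parity {a} {b} e = cong-app
  (trans (shift-by-parity a) (trans (cong (λ p → if p then inc4 else dec4) e) (sym (shift-by-parity b))))

shift-≢ : ∀ a x → shift a x ≢ x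
shift-≢ 0₄ = inc≢id
shift-≢ 1₄ = dec≢id
shift-≢ 2₄ = inc≢id
shift-≢ 3₄ = dec≢id

shift-inc-≢ : ∀ a x → shift (inc4 a) x ≢ shift a x
shift-inc-≢ 0₄ x e = inc≢dec x (sym e)
shift-inc-≢ 1₄ x e = inc≢dec x e
shift-inc-≢ 2₄ x e = inc≢dec x (sym e)
shift-inc-≢ 3₄ x e = inc≢dec x e

shift-inc-shift : ∀ a x → shift (inc4 a) (shift a x) ≡ x
shift-inc-shift 0₄ = dec∘inc
shift-inc-shift 1₄ = inc∘dec
shift-inc-shift 2₄ = dec∘inc
shift-inc-shift 3₄ = inc∘dec

shift-dec-shift : ∀ a x → shift (dec4 a) (shift a x) ≡ x
shift-dec-shift a x = trans (shift-parity (trans (even-dec a) (sym (even-inc a))) (shift a x)) (shift-inc-shift a x)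

adj-sym : ∀ {n} {x y : Vertex n} → Adj x y → Adj y x
adj-sym {x = a ∷ as} (outer plus) =
  subst (λ z → Adj (inc4 a ∷ as) (z ∷ as)) (dec∘inc a) (outer minus)
adj-sym {x = a ∷ as} (outer minus) =
  subst (λ z → Adj (dec4 a ∷ as) (z ∷ as)) (inc∘dec a) (outer plus)
adj-sym {x = a ∷ as} (inner i plus) =
  subst₂ (λ z zs → Adj (inc4 a ∷ (as [ i ]%= shift a)) (z ∷ zs)) (dec∘inc a)
    (trans (VecP.updateAt-updateAt-local i {h = id} as (shift-inc-shift a (lookup as i))) (VecP.updateAt-id i as))
    (inner i minus)
adj-sym {x = a ∷ as} (inner i minus) =
  subst₂ (λ z zs → Adj (dec4 a ∷ (as [ i ]%= shift a)) (z ∷ zs)) (inc∘dec a)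
    (trans (VecP.updateAt-updateAt-local i {h = id} as (shift-dec-shift a (lookup as i))) (VecP.updateAt-id i as))
    (inner i plus)

adj-parity : ∀ {m} {a b : Fin 4} {as bs : Vec (Fin 4) m} → Adj (a ∷ as) (b ∷ bs) → even b ≡ not (even a)
adj-parity {a = a} (outer plus) = even-inc a
adj-parity {a = a} (outer minus) = even-dec a
adj-parity {a = a} (inner _ plus) = even-inc a
adj-parity {a = a} (inner _ minus) = even-dec a

layer : ∀ {k} → Vertex (suc (suc k)) → Fin 4
layer (_ ∷ c ∷ _) = c

rest : ∀ {k} → Vertex (suc (suc k)) → Vec (Fin 4) k
rest (_ ∷ _ ∷ s) = s

adj-layer : ∀ {k} {a b c c' : Fin 4} {s s' : Vec (Fin 4) k} → Adj (a ∷ c ∷ s) (b ∷ c' ∷ s') →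
  c' ≡ c ⊎ (c' ≡ shift a c × s' ≡ s)
adj-layer = by-cases
  where
    -- matching on the edge requires its second end to be a variable
    by-cases : ∀ {k} {a c : Fin 4} {s : Vec (Fin 4) k} {y : Vertex (suc (suc k))} → Adj (a ∷ c ∷ s) y →
      layer y ≡ c ⊎ (layer y ≡ shift a c × rest y ≡ s)
    by-cases (outer _) = inj₁ refl
    by-cases (inner zero _) = inj₂ (refl , refl)
    by-cases (inner (suc _) _) = inj₁ refl

module _ {n : ℕ} {P : Vertex n → Set} where

  walk-start : ∀ {u v} → Walk P u v → P u
  walk-start (here p) = p
  walk-start (step p _ _) = p

  infixr 5 _++ʷ_
  _++ʷ_ : ∀ {u v w} → Walk P u v → Walk P v w → Walk P u w
  here _ ++ʷ q = q
  step p e w ++ʷ q = step p e (w ++ʷ q)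

  reverse-walk : ∀ {u v} → Walk P u v → Walk P v u
  reverse-walk (here p) = here p
  reverse-walk (step p e w) = reverse-walk w ++ʷ step (walk-start w) (adj-sym e) (here p)

  edge-walk : ∀ {u v} → P u → Adj u v → P v → Walk P u v
  edge-walk pu e pv = step pu e (here pv)

  connected-via-hub : ∀ (h : Vertex n) → P h → (∀ u → P u → Walk P u h) → Connected P
  connected-via-hub h ph to-hub = (h , ph) , λ u v pu pv → to-hub u pu ++ʷ reverse-walk (to-hub v pv)

walk-map : ∀ {n} {P Q : Vertex n → Set} → (∀ {x} → P x → Q x) → ∀ {u v} → Walk P u v → Walk Q u v
walk-map f (here p) = here (f p)
walk-map f (step p e w) = step (f p) e (walk-map f w)

Fault : ℕ → Set
Fault n = Vertex n ⊎ Edge n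

_≟ᵛ_ : ∀ {n} (x y : Vertex n) → Dec (x ≡ y)
_≟ᵛ_ = VecP.≡-dec FinP._≟_

hits : ∀ {n} → Fault n → Vertex n → Set
hits (inj₁ x) v = v ≡ x
hits (inj₂ e) v = v ≡ proj₁ (proj₁ e) ⊎ v ≡ proj₂ (proj₁ e)

hits? : ∀ {n} (f : Fault n) (v : Vertex n) → Dec (hits f v)
hits? (inj₁ x) v = v ≟ᵛ x
hits? (inj₂ e) v = (v ≟ᵛ proj₁ (proj₁ e)) ⊎-dec (v ≟ᵛ proj₂ (proj₁ e))

Covered : ∀ {n} → List (Fault n) → Vertex n → Set
Covered fs v = Any (λ f → hits f v) fs

covered? : ∀ {n} (fs : List (Fault n)) (v : Vertex n) → Dec (Covered fs v)
covered? fs v = any? (λ f → hits? f v) fs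

Survives : ∀ {n} → List (Fault n) → Vertex n → Set
Survives fs v = ¬ Covered fs v

-- The covering bound.  Distinct non-adjacent vertices are never covered by the
-- same fault, hence a list of pairwise separated covered vertices is no longer
-- than the list of faults.

Separated : ∀ {n} → Vertex n → Vertex n → Set
Separated x y = x ≢ y × ¬ Adj x y

hits-both-not-separated : ∀ {n} (f : Fault n) {x y} → hits f x → hits f y → ¬ Separated x y
hits-both-not-separated (inj₁ _) refl refl (x≢y , _) = x≢y refl
hits-both-not-separated (inj₂ _) (inj₁ refl) (inj₁ refl) (x≢y , _) = x≢y refl
hits-both-not-separated (inj₂ (_ , e)) (inj₁ refl) (inj₂ refl) (_ , ¬xy) = ¬xy e
hits-both-not-separated (inj₂ (_ , e)) (inj₂ refl) (inj₁ refl) (_ , ¬xy) = ¬xy (adj-sym e)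
hits-both-not-separated (inj₂ _) (inj₂ refl) (inj₂ refl) (x≢y , _) = x≢y refl

module _ {n : ℕ} (f : Fault n) where

  missed-by : List (Vertex n) → List (Vertex n)
  missed-by = filter (λ x → ¬? (hits? f x))

  missed-by-all : ∀ T → All (λ x → ¬ hits f x) T → missed-by T ≡ T
  missed-by-all [] [] = refl
  missed-by-all (x ∷ T) (m ∷ ms) with hits? f x
  ... | yes h = ⊥-elim (m h)
  ... | no _ = cong (x ∷_) (missed-by-all T ms)

  missed-by-length : ∀ T → AllPairs Separated T → length T ≤ suc (length (missed-by T))
  missed-by-length [] _ = z≤n
  missed-by-length (x ∷ T) (sx ∷ sT) with hits? f x
  ... | no _ = s≤s (missed-by-length T sT)
  ... | yes h = s≤s (≤-reflexive (sym (cong length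
        (missed-by-all T (All.map (λ s hy → hits-both-not-separated f h hy s) sx)))))

  missed-by-covered : ∀ fs T → All (Covered (f ∷ fs)) T → All (Covered fs) (missed-by T)
  missed-by-covered fs [] [] = []
  missed-by-covered fs (x ∷ T) (c ∷ cs) with hits? f x
  ... | yes _ = missed-by-covered fs T cs
  missed-by-covered fs (x ∷ T) (here h ∷ cs) | no m = ⊥-elim (m h)
  missed-by-covered fs (x ∷ T) (there c ∷ cs) | no m = c ∷ missed-by-covered fs T cs

covering-bound : ∀ {n} (fs : List (Fault n)) T → AllPairs Separated T → All (Covered fs) T → length T ≤ length fs
covering-bound [] [] _ _ = z≤n
covering-bound [] (x ∷ T) _ (() ∷ _)
covering-bound (f ∷ fs) T sep cov =
  ≤-trans (missed-by-length f T sep)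
          (s≤s (covering-bound fs (missed-by f T) (AllPairsP.filter⁺ _ sep) (missed-by-covered f fs T cov)))

separated-by-parity : ∀ {m} {p q : Fin 4} {xs ys : Vec (Fin 4) m} → even p ≡ even q →
  p ∷ xs ≢ q ∷ ys → Separated (p ∷ xs) (q ∷ ys)
separated-by-parity e ne = ne , λ a → not-¬ (trans (adj-parity a) (cong not e))
  where not-¬ : ∀ {b} → b ≢ not b
        not-¬ {true} ()
        not-¬ {false} ()

separated-by-layer : ∀ {k} {p q c c' : Fin 4} {s s' : Vec (Fin 4) k} → c' ≢ c →
  ¬ (c' ≡ shift p c × s' ≡ s) → Separated (p ∷ c ∷ s) (q ∷ c' ∷ s')
separated-by-layer c'≢c no-jump = (λ { refl → c'≢c refl }) , λ a → [ c'≢c , no-jump ]′ (adj-layer a)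

-- A gadget assigns to every position s two pairs of twins,
-- a near pair and a far pair; candidates at distinct positions are separated.
-- If the faults block every position (cover a whole pair there), the covering
-- bound counts two faults per position, plus any further separated covered
-- vertices.  So with few faults some listed position is open: it has a
-- surviving near vertex and a surviving far vertex.

data Side : Set where
  near far : Side

module Gadget {n : ℕ} (fs : List (Fault n)) {Pos : Set} (cand : Pos → Side → Bool → Vertex n)
  (twins : ∀ s side → Separated (cand s side false) (cand s side true))
  (apart : ∀ {s s'} → s ≢ s' → ∀ side side' t t' → Separated (cand s side t) (cand s' side' t'))
  where

  Open Blocked : Pos → Set
  Open s = Σ Bool λ t → Σ Bool λ t' → Survives fs (cand s near t) × Survives fs (cand s far t')
  Blocked s = Σ Side λ side → Covered fs (cand s side false) × Covered fs (cand s side true)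

  private
    survivor-or-covered : ∀ s side →
      (Σ Bool λ t → Survives fs (cand s side t)) ⊎ (Covered fs (cand s side false) × Covered fs (cand s side true))
    survivor-or-covered s side with covered? fs (cand s side false) | covered? fs (cand s side true)
    ... | no ok | _ = inj₁ (false , ok)
    ... | yes _ | no ok = inj₁ (true , ok)
    ... | yes c₀ | yes c₁ = inj₂ (c₀ , c₁)

    open-or-blocked : ∀ s → Open s ⊎ Blocked s
    open-or-blocked s with survivor-or-covered s near | survivor-or-covered s far
    ... | inj₁ (t , ok) | inj₁ (t' , ok') = inj₁ (t , t' , ok , ok')
    ... | inj₂ cs | _ = inj₂ (near , cs)
    ... | inj₁ _ | inj₂ cs = inj₂ (far , cs)

    open-or-all-blocked : ∀ xs → (Σ Pos λ s → s ∈ xs × Open s) ⊎ All Blocked xs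
    open-or-all-blocked [] = inj₂ []
    open-or-all-blocked (s ∷ xs) with open-or-blocked s | open-or-all-blocked xs
    ... | inj₁ o | _ = inj₁ (s , here refl , o)
    ... | inj₂ _ | inj₁ (s' , s'∈ , o) = inj₁ (s' , there s'∈ , o)
    ... | inj₂ b | inj₂ bs = inj₂ (b ∷ bs)

    blocked-vertices : ∀ xs → All Blocked xs → List (Vertex n)
    blocked-vertices [] [] = []
    blocked-vertices (s ∷ xs) ((side , _) ∷ bs) = cand s side false ∷ cand s side true ∷ blocked-vertices xs bs

    blocked-vertices-covered : ∀ xs bs → All (Covered fs) (blocked-vertices xs bs)
    blocked-vertices-covered [] [] = []
    blocked-vertices-covered (s ∷ xs) ((_ , c₀ , c₁) ∷ bs) = c₀ ∷ c₁ ∷ blocked-vertices-covered xs bs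

    blocked-vertices-length : ∀ xs bs → length (blocked-vertices xs bs) ≡ length xs + length xs
    blocked-vertices-length [] [] = refl
    blocked-vertices-length (s ∷ xs) (_ ∷ bs) =
      trans (cong (λ (m : ℕ) → suc (suc m)) (blocked-vertices-length xs bs))
            (cong (λ (m : ℕ) → suc m) (sym (+-suc (length xs) (length xs))))

    blocked-vertices-all : ∀ {Q : Vertex n → Set} xs bs →
      All (λ s → ∀ side t → Q (cand s side t)) xs → All Q (blocked-vertices xs bs)
    blocked-vertices-all [] [] [] = []
    blocked-vertices-all (s ∷ xs) ((side , _) ∷ bs) (q ∷ qs) = q side false ∷ q side true ∷ blocked-vertices-all xs bs qs

    blocked-vertices-separated : ∀ xs bs → Unique xs → AllPairs Separated (blocked-vertices xs bs)
    blocked-vertices-separated [] [] [] = []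
    blocked-vertices-separated (s ∷ xs) ((side , _) ∷ bs) (s∉xs ∷ u) =
      (twins s side ∷ away false) ∷ away true ∷ blocked-vertices-separated xs bs u
      where
        away : ∀ t → All (Separated (cand s side t)) (blocked-vertices xs bs)
        away t = blocked-vertices-all xs bs (All.map (λ s≢s' side' t' → apart s≢s' side side' t t') s∉xs)

  find-open : (extra : List (Vertex n)) → AllPairs Separated extra → All (Covered fs) extra →
    All (λ v → ∀ s side t → Separated v (cand s side t)) extra →
    (xs : List Pos) → Unique xs → length fs < length extra + (length xs + length xs) →
    Σ Pos λ s → s ∈ xs × Open s
  find-open extra extra-sep extra-cov extra-apart xs u few with open-or-all-blocked xs
  ... | inj₁ found = found
  ... | inj₂ bs = ⊥-elim (<⇒≱ few (begin
        length extra + (length xs + length xs)          ≡⟨ cong (length extra +_) (sym (blocked-vertices-length xs bs)) ⟩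
        length extra + length (blocked-vertices xs bs)  ≡⟨ sym (ListP.length-++ extra) ⟩
        length (extra ++ blocked-vertices xs bs)        ≤⟨ covering-bound fs _ separated covered ⟩
        length fs                                       ∎))
    where
      open ≤-Reasoning
      separated : AllPairs Separated (extra ++ blocked-vertices xs bs)
      separated = AllPairsP.++⁺ extra-sep (blocked-vertices-separated xs bs u)
        (All.map (λ away → blocked-vertices-all xs bs (All.universal (λ s side t → away s side t) xs)) extra-apart)
      covered : All (Covered fs) (extra ++ blocked-vertices xs bs)
      covered = AllP.++⁺ extra-cov (blocked-vertices-covered xs bs)

tails : ∀ {m} → (Fin 4 → Fin 4) → Vec (Fin 4) m → List (Vec (Fin 4) m)
tails f r = r ∷ tabulate (λ j → r [ j ]%= f)

tails-length : ∀ {m} (f : Fin 4 → Fin 4) (r : Vec (Fin 4) m) → length (tails f r) ≡ suc m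
tails-length f r = cong (λ (m : ℕ) → suc m) (ListP.length-tabulate (λ j → r [ j ]%= f))

tails-unique : ∀ {m} {f : Fin 4 → Fin 4} → (∀ x → f x ≢ x) → (r : Vec (Fin 4) m) → Unique (tails f r)
tails-unique {f = f} moves r = AllP.tabulate⁺ (λ j e → moved j (sym e)) ∷ UniqueP.tabulate⁺ injective
  where
    moved : ∀ j → r [ j ]%= f ≢ r
    moved j e = moves (lookup r j) (trans (sym (VecP.lookup∘updateAt j r)) (cong (λ v → lookup v j) e))

    injective : ∀ {i j} → r [ i ]%= f ≡ r [ j ]%= f → i ≡ j
    injective {i} {j} e with i FinP.≟ j
    ... | yes i≡j = i≡j
    ... | no i≢j = ⊥-elim (moves (lookup r i) (begin
          f (lookup r i)            ≡⟨ sym (VecP.lookup∘updateAt i r) ⟩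
          lookup (r [ i ]%= f) i    ≡⟨ cong (λ v → lookup v i) e ⟩
          lookup (r [ j ]%= f) i    ≡⟨ VecP.lookup∘updateAt′ i j i≢j r ⟩
          lookup r i                ∎))
      where open ≡-Reasoning

-- Inserting a_1 = c embeds BH_{k+1} into BH_{k+2}; a fault of
-- BH_{k+2} restricts to the faults of that copy: a vertex or an edge inside
-- the layer stays a vertex or edge fault, while an edge leaving the layer
-- (it changes a_1) leaves behind its end(s) in the layer as vertex faults.

keep-if : ∀ {A P : Set} → Dec P → A → List A
keep-if (yes _) x = x ∷ []
keep-if (no _) _ = []

keep-if⁺ : ∀ {A P : Set} {Q : A → Set} (d : Dec P) {x : A} → P → Q x → Any Q (keep-if d x)
keep-if⁺ (yes _) _ q = here q
keep-if⁺ (no ¬p) p _ = ⊥-elim (¬p p)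

keep-if⁻ : ∀ {A P : Set} {Q : A → Set} (d : Dec P) {x : A} → Any Q (keep-if d x) → P × Q x
keep-if⁻ (yes p) (here q) = p , q

module _ {k : ℕ} where

  embed : Fin 4 → Vertex (suc k) → Vertex (suc (suc k))
  embed c (a ∷ s) = a ∷ c ∷ s

  embed-adj : ∀ c {v w : Vertex (suc k)} → Adj v w → Adj (embed c v) (embed c w)
  embed-adj c (outer pm) = outer pm
  embed-adj c (inner j pm) = inner (suc j) pm

  restrict : Fin 4 → Fault (suc (suc k)) → List (Fault (suc k))
  restrict c (inj₁ (a ∷ c' ∷ s)) = keep-if (c' FinP.≟ c) (inj₁ (a ∷ s))
  restrict c (inj₂ (_ , outer {a = a} {b} {c' ∷ s} pm)) =
    keep-if (c' FinP.≟ c) (inj₂ ((a ∷ s , b ∷ s) , outer pm))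
  restrict c (inj₂ (_ , inner {a = a} {b} {c' ∷ s} zero pm)) =
    keep-if (c' FinP.≟ c) (inj₁ (a ∷ s)) ++ keep-if (shift a c' FinP.≟ c) (inj₁ (b ∷ s))
  restrict c (inj₂ (_ , inner {a = a} {b} {c' ∷ s} (suc j) pm)) =
    keep-if (c' FinP.≟ c) (inj₂ ((a ∷ s , b ∷ (s [ j ]%= shift a)) , inner j pm))

  layer-faults : Fin 4 → List (Fault (suc (suc k))) → List (Fault (suc k))
  layer-faults c = concatMap (restrict c)

  private
    V₂ V₁ : Set
    V₂ = Vertex (suc (suc k))
    V₁ = Vertex (suc k)

    unembed : ∀ {x a c c' : Fin 4} {t s : Vec (Fin 4) k} →
      (V₂ ∋ x ∷ c ∷ t) ≡ a ∷ c' ∷ s → c' ≡ c × (V₁ ∋ x ∷ t) ≡ a ∷ s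
    unembed refl = refl , refl

    reembed : ∀ {x a c c' : Fin 4} {t s : Vec (Fin 4) k} →
      c' ≡ c → (V₁ ∋ x ∷ t) ≡ a ∷ s → (V₂ ∋ x ∷ c ∷ t) ≡ a ∷ c' ∷ s
    reembed refl refl = refl

    unembed-pair : ∀ {x a b c c' : Fin 4} {t s s' : Vec (Fin 4) k} →
      (V₂ ∋ x ∷ c ∷ t) ≡ a ∷ c' ∷ s ⊎ (V₂ ∋ x ∷ c ∷ t) ≡ b ∷ c' ∷ s' →
      c' ≡ c × ((V₁ ∋ x ∷ t) ≡ a ∷ s ⊎ (V₁ ∋ x ∷ t) ≡ b ∷ s')
    unembed-pair (inj₁ e) = proj₁ (unembed e) , inj₁ (proj₂ (unembed e))
    unembed-pair (inj₂ e) = proj₁ (unembed e) , inj₂ (proj₂ (unembed e))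

    reembed-pair : ∀ {x a b c c' : Fin 4} {t s s' : Vec (Fin 4) k} → c' ≡ c →
      (V₁ ∋ x ∷ t) ≡ a ∷ s ⊎ (V₁ ∋ x ∷ t) ≡ b ∷ s' →
      (V₂ ∋ x ∷ c ∷ t) ≡ a ∷ c' ∷ s ⊎ (V₂ ∋ x ∷ c ∷ t) ≡ b ∷ c' ∷ s'
    reembed-pair l (inj₁ e) = inj₁ (reembed l e)
    reembed-pair l (inj₂ e) = inj₂ (reembed l e)

  restrict-hits⁺ : ∀ c f (v : Vertex (suc k)) → hits f (embed c v) → Any (λ g → hits g v) (restrict c f)
  restrict-hits⁺ c (inj₁ (a ∷ c' ∷ s)) (x ∷ t) h =
    keep-if⁺ (c' FinP.≟ c) (proj₁ (unembed h)) (proj₂ (unembed h))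
  restrict-hits⁺ c (inj₂ (_ , outer {as = c' ∷ s} pm)) (x ∷ t) h =
    keep-if⁺ (c' FinP.≟ c) (proj₁ (unembed-pair h)) (proj₂ (unembed-pair h))
  restrict-hits⁺ c (inj₂ (_ , inner {a = a} {b} {c' ∷ s} zero pm)) (x ∷ t) (inj₁ h) =
    AnyP.++⁺ˡ (keep-if⁺ (c' FinP.≟ c) (proj₁ (unembed h)) (proj₂ (unembed h)))
  restrict-hits⁺ c (inj₂ (_ , inner {a = a} {b} {c' ∷ s} zero pm)) (x ∷ t) (inj₂ h) =
    AnyP.++⁺ʳ (keep-if (c' FinP.≟ c) (inj₁ (a ∷ s)))
      (keep-if⁺ (shift a c' FinP.≟ c) (proj₁ (unembed h)) (proj₂ (unembed h)))
  restrict-hits⁺ c (inj₂ (_ , inner {as = c' ∷ s} (suc j) pm)) (x ∷ t) h =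
    keep-if⁺ (c' FinP.≟ c) (proj₁ (unembed-pair h)) (proj₂ (unembed-pair h))

  restrict-hits⁻ : ∀ c f (v : Vertex (suc k)) → Any (λ g → hits g v) (restrict c f) → hits f (embed c v)
  restrict-hits⁻ c (inj₁ (a ∷ c' ∷ s)) (x ∷ t) h =
    let (l , e) = keep-if⁻ (c' FinP.≟ c) h in reembed l e
  restrict-hits⁻ c (inj₂ (_ , outer {as = c' ∷ s} pm)) (x ∷ t) h =
    let (l , e) = keep-if⁻ (c' FinP.≟ c) h in reembed-pair l e
  restrict-hits⁻ c (inj₂ (_ , inner {a = a} {b} {c' ∷ s} zero pm)) (x ∷ t) h
    with AnyP.++⁻ (keep-if (c' FinP.≟ c) (inj₁ (a ∷ s))) h
  ... | inj₁ h₁ = let (l , e) = keep-if⁻ (c' FinP.≟ c) h₁ in inj₁ (reembed l e)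
  ... | inj₂ h₂ = let (l , e) = keep-if⁻ (shift a c' FinP.≟ c) h₂ in inj₂ (reembed l e)
  restrict-hits⁻ c (inj₂ (_ , inner {as = c' ∷ s} (suc j) pm)) (x ∷ t) h =
    let (l , e) = keep-if⁻ (c' FinP.≟ c) h in reembed-pair l e

  layer-covered⁺ : ∀ c fs v → Covered fs (embed c v) → Covered (layer-faults c fs) v
  layer-covered⁺ c (f ∷ fs) v (here h) = AnyP.++⁺ˡ (restrict-hits⁺ c f v h)
  layer-covered⁺ c (f ∷ fs) v (there h) = AnyP.++⁺ʳ (restrict c f) (layer-covered⁺ c fs v h)

  layer-covered⁻ : ∀ c fs v → Covered (layer-faults c fs) v → Covered fs (embed c v)
  layer-covered⁻ c (f ∷ fs) v h with AnyP.++⁻ (restrict c f) h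
  ... | inj₁ h₁ = here (restrict-hits⁻ c f v h₁)
  ... | inj₂ h₂ = there (layer-covered⁻ c fs v h₂)

  layer-walk : ∀ c fs {v w} → Walk (Survives (layer-faults c fs)) v w → Walk (Survives fs) (embed c v) (embed c w)
  layer-walk c fs {v} (here ok) = here (ok ∘ layer-covered⁺ c fs v)
  layer-walk c fs {v} (step ok e w) = step (ok ∘ layer-covered⁺ c fs v) (embed-adj c e) (layer-walk c fs w)

  within-layer : ∀ c fs → Connected (Survives (layer-faults c fs)) →
    ∀ x y → layer x ≡ c → layer y ≡ c → Survives fs x → Survives fs y → Walk (Survives fs) x y
  within-layer c fs (_ , joined) (a ∷ .c ∷ s) (b ∷ .c ∷ t) refl refl ok-x ok-y =
    layer-walk c fs (joined (a ∷ s) (b ∷ t) (ok-x ∘ layer-covered⁻ c fs _) (ok-y ∘ layer-covered⁻ c fs _))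

-- Layered gadgets: the candidate at position s is (head side t, lay side, s),
-- i.e. each side lives in one layer, the two layers differ, and the heads on a
-- side are distinct but of equal parity.  This makes all separation
-- hypotheses of the gadget lemma automatic.

module LayeredGadget {k : ℕ} (fs : List (Fault (suc (suc k))))
  (head : Side → Bool → Fin 4) (lay : Side → Fin 4) (side-parity : Side → Bool)
  (head-parity : ∀ side t → even (head side t) ≡ side-parity side)
  (heads-differ : ∀ side → head side false ≢ head side true)
  (layers-differ : lay far ≢ lay near)
  where

  cand : Vec (Fin 4) k → Side → Bool → Vertex (suc (suc k))
  cand s side t = head side t ∷ lay side ∷ s

  private
    same-parity : ∀ side t t' → even (head side t) ≡ even (head side t')
    same-parity side t t' = trans (head-parity side t) (sym (head-parity side t'))

    twins : ∀ s side → Separated (cand s side false) (cand s side true)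
    twins s side = separated-by-parity (same-parity side false true) (heads-differ side ∘ VecP.∷-injectiveˡ)

    apart : ∀ {s s'} → s ≢ s' → ∀ side side' t t' → Separated (cand s side t) (cand s' side' t')
    apart s≢s' near near t t' = separated-by-parity (same-parity near t t') (s≢s' ∘ cong rest)
    apart s≢s' far far t t' = separated-by-parity (same-parity far t t') (s≢s' ∘ cong rest)
    apart s≢s' near far t t' = separated-by-layer layers-differ (λ (_ , e) → s≢s' (sym e))
    apart s≢s' far near t t' = separated-by-layer (layers-differ ∘ sym) (λ (_ , e) → s≢s' (sym e))

  open Gadget fs cand twins apart public

-- Escape: a survivor u in any layer reaches a survivor in another layer,
-- provided there are fewer than 2(k+2) faults.  Either an edge of u leaving the
-- layer survives, or, with both of those ends covered, the gadget on the
-- in-layer neighbours of u yields a surviving two-step path out of the layer.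

record Escape {k : ℕ} (fs : List (Fault (suc (suc k)))) (u : Vertex (suc (suc k))) : Set where
  field
    target : Vertex (suc (suc k))
    target-survives : Survives fs target
    walk : Walk (Survives fs) u target
    leaves : layer target ≢ layer u

module _ {k : ℕ} (fs : List (Fault (suc (suc k)))) (a c : Fin 4) (r : Vec (Fin 4) k) where

  private
    u : Vertex (suc (suc k))
    u = a ∷ c ∷ r

    -- the layer reached by the second step of the detour
    c″ : Fin 4
    c″ = shift (inc4 a) c

    head : Side → Bool → Fin 4
    head near false = inc4 a
    head near true = dec4 a
    head far false = a
    head far true = inc4 (inc4 a)

    lay : Side → Fin 4
    lay near = c
    lay far = c″

    side-parity : Side → Bool
    side-parity near = not (even a)
    side-parity far = even a

    head-parity : ∀ side t → even (head side t) ≡ side-parity side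
    head-parity near false = even-inc a
    head-parity near true = even-dec a
    head-parity far false = refl
    head-parity far true = even-inc² a

    heads-differ : ∀ side → head side false ≢ head side true
    heads-differ near = inc≢dec a
    heads-differ far = inc²≢id a ∘ sym

    open LayeredGadget fs head lay side-parity head-parity heads-differ (shift-≢ (inc4 a) c)

    first-step : ∀ {s} → s ∈ tails (shift a) r → ∀ t → Adj u (cand s near t)
    first-step (here refl) false = outer plus
    first-step (here refl) true = outer minus
    first-step (there s∈) t with ∈-tabulate⁻ s∈
    first-step (there s∈) false | j , refl = inner (suc j) plus
    first-step (there s∈) true | j , refl = inner (suc j) minus

    second-step : ∀ s t t' → Adj (cand s near t) (cand s far t')
    second-step s false false = subst (λ z → Adj (inc4 a ∷ c ∷ s) (z ∷ c″ ∷ s)) (dec∘inc a) (inner zero minus)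
    second-step s false true = inner zero plus
    second-step s true false = subst₂ (λ z w → Adj (dec4 a ∷ c ∷ s) (z ∷ w ∷ s)) (inc∘dec a)
      (shift-parity (trans (even-dec a) (sym (even-inc a))) c) (inner zero plus)
    second-step s true true = subst₂ (λ z w → Adj (dec4 a ∷ c ∷ s) (z ∷ w ∷ s)) (dec∘dec a)
      (shift-parity (trans (even-dec a) (sym (even-inc a))) c) (inner zero minus)

    exit : Fin 4 → Vertex (suc (suc k))
    exit p = p ∷ shift a c ∷ r

    exit-apart : ∀ p → even p ≡ not (even a) → shift p (shift a c) ≡ c →
      ∀ s side t → Separated (exit p) (cand s side t)
    exit-apart p parity _ s near t =
      separated-by-parity (trans parity (sym (head-parity near t))) (shift-≢ a c ∘ cong layer)
    exit-apart p _ returns s far t =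
      separated-by-layer (shift-inc-≢ a c) (λ (e , _) → shift-≢ (inc4 a) c (trans e returns))

    exit⁺-apart : ∀ s side t → Separated (exit (inc4 a)) (cand s side t)
    exit⁺-apart = exit-apart (inc4 a) (even-inc a) (shift-inc-shift a c)

    exit⁻-apart : ∀ s side t → Separated (exit (dec4 a)) (cand s side t)
    exit⁻-apart = exit-apart (dec4 a) (even-dec a) (shift-dec-shift a c)

    exits-separated : Separated (exit (inc4 a)) (exit (dec4 a))
    exits-separated = separated-by-parity (trans (even-inc a) (sym (even-dec a))) (inc≢dec a ∘ VecP.∷-injectiveˡ)

    leaves-by-exit : layer (exit (inc4 a)) ≢ c
    leaves-by-exit = shift-≢ a c

    -- 2 exits and k + 1 positions with two twins each exceed the faults
    enough : length fs < 2 * suc (suc k) → length fs < 2 + (length (tails (shift a) r) + length (tails (shift a) r))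
    enough few = subst (λ m → length fs < 2 + (m + m)) (sym (tails-length (shift a) r))
                   (subst (length fs <_) (double-suc (suc k)) few)
      where double-suc : ∀ m → 2 * suc m ≡ 2 + (m + m)
            double-suc = solve-∀

  escape : length fs < 2 * suc (suc k) → Survives fs u → Escape fs u
  escape few ok with covered? fs (exit (inc4 a)) | covered? fs (exit (dec4 a))
  ... | no ok⁺ | _ = record
    { target-survives = ok⁺ ; walk = edge-walk ok (inner zero plus) ok⁺ ; leaves = leaves-by-exit }
  ... | yes _ | no ok⁻ = record
    { target-survives = ok⁻ ; walk = edge-walk ok (inner zero minus) ok⁻ ; leaves = leaves-by-exit }
  ... | yes cov⁺ | yes cov⁻
    with find-open (exit (inc4 a) ∷ exit (dec4 a) ∷ []) ((exits-separated ∷ []) ∷ [] ∷ [])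
           (cov⁺ ∷ cov⁻ ∷ []) (exit⁺-apart ∷ exit⁻-apart ∷ [])
           (tails (shift a) r) (tails-unique (shift-≢ a) r) (enough few)
  ... | s , s∈ , t , t' , ok-near , ok-far = record
    { target-survives = ok-far
    ; walk = step ok (first-step s∈ t) (edge-walk ok-near (second-step s t t') ok-far)
    ; leaves = shift-≢ (inc4 a) c }

-- The gadget at tail s consists of
-- (0, c, s), (2, c, s) on the near side and (1, c+1, s), (3, c+1, s) on the
-- far side, every near one adjacent to every far one; k + 3 distinct tails
-- suffice.

record Bridge {k : ℕ} (fs : List (Fault (suc (suc k)))) (c c' : Fin 4) : Set where
  field
    from to : Vertex (suc (suc k))
    from-survives : Survives fs from
    to-survives : Survives fs to
    from-layer : layer from ≡ c
    to-layer : layer to ≡ c'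
    edge : Adj from to

module _ {k : ℕ} (fs : List (Fault (suc (suc (suc k))))) (c : Fin 4) where

  private
    head : Side → Bool → Fin 4
    head near false = 0₄
    head near true = 2₄
    head far false = 1₄
    head far true = 3₄

    lay : Side → Fin 4
    lay near = c
    lay far = inc4 c

    side-parity : Side → Bool
    side-parity near = true
    side-parity far = false

    head-parity : ∀ side t → even (head side t) ≡ side-parity side
    head-parity near false = refl
    head-parity near true = refl
    head-parity far false = refl
    head-parity far true = refl

    heads-differ : ∀ side → head side false ≢ head side true
    heads-differ near ()
    heads-differ far ()

    open LayeredGadget fs head lay side-parity head-parity heads-differ (inc≢id c)

    crossing : ∀ s t t' → Adj (cand s near t) (cand s far t')
    crossing s false false = inner zero plus
    crossing s false true = inner zero minus
    crossing s true false = inner zero minus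
    crossing s true true = inner zero plus

    zeros : Vec (Fin 4) (suc k)
    zeros = replicate (suc k) 0₄

    positions : List (Vec (Fin 4) (suc k))
    positions = (3₄ ∷ replicate k 0₄) ∷ tails inc4 zeros

    positions-unique : Unique positions
    positions-unique = ((λ ()) ∷ AllP.tabulate⁺ {f = λ j → zeros [ j ]%= inc4} (λ { zero () ; (suc j) () }))
                     ∷ tails-unique inc≢id zeros

    -- k + 3 positions with two twins each exceed the faults
    enough : length fs < 2 * suc (suc (suc k)) → length fs < length positions + length positions
    enough few = subst (λ m → length fs < suc m + suc m) (sym (tails-length inc4 zeros))
                   (subst (length fs <_) (cong (suc (suc (suc k)) +_) (+-identityʳ _)) few)

  bridge : length fs < 2 * suc (suc (suc k)) → Bridge fs c (inc4 c)
  bridge few with find-open [] [] [] [] positions positions-unique (enough few)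
  ... | s , _ , t , t' , ok , ok' = record
    { from-survives = ok ; to-survives = ok' ; from-layer = refl ; to-layer = refl ; edge = crossing s t t' }

module Automorphism {n : ℕ} (σ : Vertex n → Vertex n) (σ-invol : ∀ x → σ (σ x) ≡ x)
  (σ-adj : ∀ {x y} → Adj x y → Adj (σ x) (σ y)) where

  σ-fault : Fault n → Fault n
  σ-fault (inj₁ x) = inj₁ (σ x)
  σ-fault (inj₂ ((x , y) , e)) = inj₂ ((σ x , σ y) , σ-adj e)

  private
    σ-injective : ∀ {x y} → σ x ≡ σ y → x ≡ y
    σ-injective {x} {y} e = trans (sym (σ-invol x)) (trans (cong σ e) (σ-invol y))

    σ-hits⁺ : ∀ f {v} → hits f v → hits (σ-fault f) (σ v)
    σ-hits⁺ (inj₁ _) h = cong σ h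
    σ-hits⁺ (inj₂ _) (inj₁ h) = inj₁ (cong σ h)
    σ-hits⁺ (inj₂ _) (inj₂ h) = inj₂ (cong σ h)

    σ-hits⁻ : ∀ f {v} → hits (σ-fault f) (σ v) → hits f v
    σ-hits⁻ (inj₁ _) h = σ-injective h
    σ-hits⁻ (inj₂ _) (inj₁ h) = inj₁ (σ-injective h)
    σ-hits⁻ (inj₂ _) (inj₂ h) = inj₂ (σ-injective h)

    σ-survives : ∀ fs {v} → Survives (map σ-fault fs) v → Survives fs (σ v)
    σ-survives fs {v} ok c =
      ok (subst (Covered (map σ-fault fs)) (σ-invol v) (AnyP.map⁺ (Any.map (λ {f} → σ-hits⁺ f) c)))

    σ-survives⁻ : ∀ fs {v} → Survives fs v → Survives (map σ-fault fs) (σ v)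
    σ-survives⁻ fs ok c = ok (Any.map (λ {f} → σ-hits⁻ f) (AnyP.map⁻ c))

    σ-walk : ∀ fs {x y} → Walk (Survives (map σ-fault fs)) x y → Walk (Survives fs) (σ x) (σ y)
    σ-walk fs (here ok) = here (σ-survives fs ok)
    σ-walk fs (step ok e w) = step (σ-survives fs ok) (σ-adj e) (σ-walk fs w)

  transport : ∀ fs → Connected (Survives (map σ-fault fs)) → Connected (Survives fs)
  transport fs ((w , ok) , joined) = (σ w , σ-survives fs ok) , λ u v ok-u ok-v →
    subst₂ (Walk (Survives fs)) (σ-invol u) (σ-invol v)
      (σ-walk fs (joined (σ u) (σ v) (σ-survives⁻ fs ok-u) (σ-survives⁻ fs ok-v)))

swap₁₂ : ∀ {k} → Vertex (suc (suc (suc k))) → Vertex (suc (suc (suc k)))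
swap₁₂ (a ∷ c₁ ∷ c₂ ∷ s) = a ∷ c₂ ∷ c₁ ∷ s

swap₁₂-invol : ∀ {k} (x : Vertex (suc (suc (suc k)))) → swap₁₂ (swap₁₂ x) ≡ x
swap₁₂-invol (a ∷ c₁ ∷ c₂ ∷ s) = refl

swap₁₂-adj : ∀ {k} {x y : Vertex (suc (suc (suc k)))} → Adj x y → Adj (swap₁₂ x) (swap₁₂ y)
swap₁₂-adj {x = _ ∷ _ ∷ _ ∷ _} (outer pm) = outer pm
swap₁₂-adj {x = _ ∷ _ ∷ _ ∷ _} (inner zero pm) = inner (suc zero) pm
swap₁₂-adj {x = _ ∷ _ ∷ _ ∷ _} (inner (suc zero) pm) = inner zero pm
swap₁₂-adj {x = _ ∷ _ ∷ _ ∷ _} (inner (suc (suc j)) pm) = inner (suc (suc j)) pm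

module Swap {k : ℕ} = Automorphism (swap₁₂ {k}) swap₁₂-invol swap₁₂-adj

-- A fault of BH_{k+3} induces at most one fault in
-- each layer, and in at most one layer of a_1 unless it is an edge changing
-- a_1; such an edge keeps a_2, so over two layers of a_1 and two layers of
-- a_2 every fault induces at most three faults in total.

module _ {k : ℕ} where

  open Swap {k}

  load : Fin 4 → List (Fault (suc (suc (suc k)))) → ℕ
  load c fs = length (layer-faults c fs)

  private
    share : Fin 4 → Fault (suc (suc (suc k))) → ℕ
    share c f = length (restrict c f)

    load-∷ : ∀ c f fs → load c (f ∷ fs) ≡ share c f + load c fs
    load-∷ c f fs = ListP.length-++ (restrict c f)

    kept-once : ∀ {A : Set} (x y : A) (c a b : Fin 4) → a ≢ b →
      length (keep-if (c FinP.≟ a) x) + length (keep-if (c FinP.≟ b) y) ≤ 1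
    kept-once x y c a b a≢b with c FinP.≟ a | c FinP.≟ b
    ... | yes refl | yes refl = ⊥-elim (a≢b refl)
    ... | yes _ | no _ = s≤s z≤n
    ... | no _ | yes _ = s≤s z≤n
    ... | no _ | no _ = z≤n

    kept-twice : ∀ {A : Set} (x y x' y' : A) (c c' a b : Fin 4) → a ≢ b →
      length (keep-if (c FinP.≟ a) x ++ keep-if (c' FinP.≟ a) y) +
      length (keep-if (c FinP.≟ b) x' ++ keep-if (c' FinP.≟ b) y') ≤ 2
    kept-twice x y x' y' c c' a b a≢b
      rewrite ListP.length-++ (keep-if (c FinP.≟ a) x) {keep-if (c' FinP.≟ a) y}
            | ListP.length-++ (keep-if (c FinP.≟ b) x') {keep-if (c' FinP.≟ b) y'} =
      subst (_≤ 2) (interchange (length (keep-if (c FinP.≟ a) x)) (length (keep-if (c' FinP.≟ a) y))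
                                (length (keep-if (c FinP.≟ b) x')) (length (keep-if (c' FinP.≟ b) y')))
        (+-mono-≤ (kept-once x x' c a b a≢b) (kept-once y y' c' a b a≢b))
      where
        interchange : ∀ p q r s → (p + r) + (q + s) ≡ (p + q) + (r + s)
        interchange = solve-∀

    share-bound : ∀ {a b a' b'} → a ≢ b → a' ≢ b' → ∀ f →
      share a f + share b f + (share a' (σ-fault f) + share b' (σ-fault f)) ≤ 3
    share-bound {a} {b} {a'} {b'} a≢b a'≢b' (inj₁ (x ∷ c₁ ∷ c₂ ∷ s)) =
      m≤n⇒m≤1+n (+-mono-≤ (kept-once _ _ c₁ a b a≢b) (kept-once _ _ c₂ a' b' a'≢b'))
    share-bound {a} {b} {a'} {b'} a≢b a'≢b' (inj₂ (_ , outer {as = c₁ ∷ c₂ ∷ s} pm)) =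
      m≤n⇒m≤1+n (+-mono-≤ (kept-once _ _ c₁ a b a≢b) (kept-once _ _ c₂ a' b' a'≢b'))
    share-bound {a} {b} {a'} {b'} a≢b a'≢b' (inj₂ (_ , inner {a = x} {as = c₁ ∷ c₂ ∷ s} zero pm)) =
      +-mono-≤ (kept-twice _ _ _ _ c₁ (shift x c₁) a b a≢b) (kept-once _ _ c₂ a' b' a'≢b')
    share-bound {a} {b} {a'} {b'} a≢b a'≢b' (inj₂ (_ , inner {a = x} {as = c₁ ∷ c₂ ∷ s} (suc zero) pm)) =
      +-mono-≤ (kept-once _ _ c₁ a b a≢b) (kept-twice _ _ _ _ c₂ (shift x c₂) a' b' a'≢b')
    share-bound {a} {b} {a'} {b'} a≢b a'≢b' (inj₂ (_ , inner {as = c₁ ∷ c₂ ∷ s} (suc (suc j)) pm)) =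
      m≤n⇒m≤1+n (+-mono-≤ (kept-once _ _ c₁ a b a≢b) (kept-once _ _ c₂ a' b' a'≢b'))

  load-bound : ∀ {a b a' b'} → a ≢ b → a' ≢ b' → ∀ fs →
    load a fs + load b fs + (load a' (map σ-fault fs) + load b' (map σ-fault fs)) ≤ 3 * length fs
  load-bound a≢b a'≢b' [] = z≤n
  load-bound {a} {b} {a'} {b'} a≢b a'≢b' (f ∷ fs)
    rewrite load-∷ a f fs | load-∷ b f fs | load-∷ a' (σ-fault f) (map σ-fault fs) | load-∷ b' (σ-fault f) (map σ-fault fs) =
    subst₂ _≤_ (sym (regroup (share a f) (share b f) (share a' (σ-fault f)) (share b' (σ-fault f))
                             (load a fs) (load b fs) (load a' (map σ-fault fs)) (load b' (map σ-fault fs))))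
               (sym (*-suc 3 (length fs)))
      (+-mono-≤ (share-bound a≢b a'≢b' f) (load-bound a≢b a'≢b' fs))
    where
      regroup : ∀ x₁ x₂ x₃ x₄ y₁ y₂ y₃ y₄ →
        (x₁ + y₁) + (x₂ + y₂) + ((x₃ + y₃) + (x₄ + y₄)) ≡ (x₁ + x₂ + (x₃ + x₄)) + (y₁ + y₂ + (y₃ + y₄))
      regroup = solve-∀

at-most-one-or-two : ∀ {m} (P : Fin (suc m) → Set) → (∀ c → Dec (P c)) →
  (Σ (Fin (suc m)) λ β → ∀ c → c ≢ β → ¬ P c) ⊎ (Σ (Fin (suc m)) λ a → Σ (Fin (suc m)) λ b → a ≢ b × P a × P b)
at-most-one-or-two P P? with FinP.any? P?
... | no none = inj₁ (zero , λ c _ pc → none (c , pc))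
... | yes (a , pa) with FinP.any? (λ b → ¬? (b FinP.≟ a) ×-dec P? b)
...   | yes (b , b≢a , pb) = inj₂ (a , b , (λ e → b≢a (sym e)) , pa , pb)
...   | no none = inj₁ (a , λ c c≢a pc → none (c , c≢a , pc))

-- Four overloaded layers (two of a_1 and two of a_2) need more than 2n − 1
-- faults when n ≥ 3: 4 · 2(n − 1) > 3 · (2n − 1).
four-overloads-impossible : ∀ k L → 4 * (2 * suc (suc k)) ≤ 3 * L → L < 2 * suc (suc (suc k)) → ⊥
four-overloads-impossible k L overloads few = <-irrefl refl (begin-strict
  3 * (2 * suc (suc (suc k)))               <⟨ m<m+n _ (s≤s z≤n) ⟩
  3 * (2 * suc (suc (suc k))) + suc (2 * k)  ≡⟨ sym (expand k) ⟩
  4 * (2 * suc (suc k)) + 3                 ≤⟨ +-monoˡ-≤ 3 overloads ⟩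
  3 * L + 3                                 ≡⟨ +-comm (3 * L) 3 ⟩
  3 + 3 * L                                 ≡⟨ sym (*-suc 3 L) ⟩
  3 * suc L                                 ≤⟨ *-monoʳ-≤ 3 few ⟩
  3 * (2 * suc (suc (suc k)))               ∎)
  where
    open ≤-Reasoning
    expand : ∀ k → 4 * (2 * suc (suc k)) + 3 ≡ 3 * (2 * suc (suc (suc k))) + suc (2 * k)
    expand = solve-∀

-- If every layer except possibly β is
-- connected, then BH_{k+3} minus the faults is connected: the layers β+1,
-- β+2, β+3 are chained by bridges, the far end of the first bridge serves as
-- hub, and a survivor in layer β first escapes into another layer.

layer-cases : ∀ β c → c ≡ β ⊎ c ≡ inc4 β ⊎ c ≡ inc4 (inc4 β) ⊎ c ≡ inc4 (inc4 (inc4 β))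
layer-cases = toWitness {a? = FinP.all? λ β → FinP.all? λ c →
  (c FinP.≟ β) ⊎-dec (c FinP.≟ inc4 β) ⊎-dec (c FinP.≟ inc4 (inc4 β)) ⊎-dec (c FinP.≟ inc4 (inc4 (inc4 β)))} _

module _ {k : ℕ} (fs : List (Fault (suc (suc (suc k))))) (few : length fs < 2 * suc (suc (suc k)))
  (β : Fin 4) (layers-connected : ∀ c → c ≢ β → Connected (Survives (layer-faults c fs))) where

  private
    W : Vertex (suc (suc (suc k))) → Vertex (suc (suc (suc k))) → Set
    W = Walk (Survives fs)

    within : ∀ c → c ≢ β → ∀ {x y} → layer x ≡ c → layer y ≡ c → Survives fs x → Survives fs y → W x y
    within c c≢β {x} {y} = within-layer c fs (layers-connected c c≢β) x y

    first : Bridge fs (inc4 β) (inc4 (inc4 β))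
    first = bridge fs (inc4 β) few

    second : Bridge fs (inc4 (inc4 β)) (inc4 (inc4 (inc4 β)))
    second = bridge fs (inc4 (inc4 β)) few

    open Bridge

    hub : Vertex (suc (suc (suc k)))
    hub = to first

    from-other-layer : ∀ y → Survives fs y → layer y ≢ β → W y hub
    from-other-layer y ok y∉β with layer-cases β (layer y)
    ... | inj₁ l = ⊥-elim (y∉β l)
    ... | inj₂ (inj₁ l) =
      within (inc4 β) (inc≢id β) l (from-layer first) ok (from-survives first)
      ++ʷ edge-walk (from-survives first) (edge first) (to-survives first)
    ... | inj₂ (inj₂ (inj₁ l)) =
      within (inc4 (inc4 β)) (inc²≢id β) l (to-layer first) ok (to-survives first)
    ... | inj₂ (inj₂ (inj₂ l)) =
      within (inc4 (inc4 (inc4 β))) (inc³≢id β) l (to-layer second) ok (to-survives second)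
      ++ʷ edge-walk (to-survives second) (adj-sym (edge second)) (from-survives second)
      ++ʷ within (inc4 (inc4 β)) (inc²≢id β) (from-layer second) (to-layer first)
            (from-survives second) (to-survives first)

    to-hub : ∀ x → Survives fs x → W x hub
    to-hub x@(a ∷ c ∷ r) ok with c FinP.≟ β
    ... | no c≢β = from-other-layer x ok c≢β
    ... | yes refl =
      Escape.walk out ++ʷ from-other-layer (Escape.target out) (Escape.target-survives out) (Escape.leaves out)
      where out = escape fs a c r few ok

  connected-from-layers : Connected (Survives fs)
  connected-from-layers = connected-via-hub hub (to-survives first) to-hub

-- The inductive step: choose the layering (by a_1, or by a_2 after swapping)
-- in which at most one layer β is overloaded, i.e. carries 2(k+2) or more
-- induced faults; the other layers are connected by the induction hypothesis.

module _ {k : ℕ} (induction : ∀ (gs : List (Fault (suc (suc k)))) → length gs < 2 * suc (suc k) → Connected (Survives gs))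
  where

  private
    Overloaded : List (Fault (suc (suc (suc k)))) → Fin 4 → Set
    Overloaded fs c = 2 * suc (suc k) ≤ load c fs

    all-but-one : ∀ fs → length fs < 2 * suc (suc (suc k)) → (β : Fin 4) → (∀ c → c ≢ β → ¬ Overloaded fs c) →
      Connected (Survives fs)
    all-but-one fs few β fine = connected-from-layers fs few β λ c c≢β → induction _ (≰⇒> (fine c c≢β))

    open Swap {k}

  inductive-step : ∀ fs → length fs < 2 * suc (suc (suc k)) → Connected (Survives fs)
  inductive-step fs few with at-most-one-or-two (Overloaded fs) (λ c → _ ≤? load c fs)
  ... | inj₁ (β , fine) = all-but-one fs few β fine
  ... | inj₂ (a , b , a≢b , over-a , over-b)
    with at-most-one-or-two (Overloaded (map σ-fault fs)) (λ c → _ ≤? load c (map σ-fault fs))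
  ...   | inj₁ (β , fine) =
    transport fs (all-but-one (map σ-fault fs) (subst (_< _) (sym (ListP.length-map σ-fault fs)) few) β fine)
  ...   | inj₂ (a' , b' , a'≢b' , over-a' , over-b') =
    ⊥-elim (four-overloads-impossible k (length fs) overloaded few)
    where
      overloaded : 4 * (2 * suc (suc k)) ≤ 3 * length fs
      overloaded = ≤-trans (≤-reflexive (four-times (2 * suc (suc k))))
        (≤-trans (+-mono-≤ (+-mono-≤ over-a over-b) (+-mono-≤ over-a' over-b')) (load-bound a≢b a'≢b' fs))
        where four-times : ∀ t → 4 * t ≡ t + t + (t + t)
              four-times = solve-∀

-- The base case n = 2.  BH_2 has 16 vertices; the vertices (a, c) and
-- (a + 2, c) are twins with the same neighbours, and the 8 twin classes form
-- a cycle in which each class is completely joined to the two next to it.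
-- Fewer than four faults cannot kill two classes that are not next to each
-- other, so all classes outside some pair {d, d + 1} stay alive and the
-- survivors are connected along the remaining six consecutive classes.

next : Fin 8 → Fin 8
next zero = suc zero
next (suc zero) = suc (suc zero)
next (suc (suc zero)) = suc (suc (suc zero))
next (suc (suc (suc zero))) = suc (suc (suc (suc zero)))
next (suc (suc (suc (suc zero)))) = suc (suc (suc (suc (suc zero))))
next (suc (suc (suc (suc (suc zero))))) = suc (suc (suc (suc (suc (suc zero)))))
next (suc (suc (suc (suc (suc (suc zero)))))) = suc (suc (suc (suc (suc (suc (suc zero))))))
next (suc (suc (suc (suc (suc (suc (suc zero))))))) = zero

arc : Fin 8 → ℕ → Fin 8
arc d zero = d
arc d (suc m) = next (arc d m)

prev : Fin 8 → Fin 8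
prev d = arc d 7

member : Fin 8 → Bool → Vertex 2
member zero false = 0₄ ∷ 0₄ ∷ []
member zero true = 2₄ ∷ 0₄ ∷ []
member (suc zero) false = 1₄ ∷ 1₄ ∷ []
member (suc zero) true = 3₄ ∷ 1₄ ∷ []
member (suc (suc zero)) false = 0₄ ∷ 1₄ ∷ []
member (suc (suc zero)) true = 2₄ ∷ 1₄ ∷ []
member (suc (suc (suc zero))) false = 1₄ ∷ 2₄ ∷ []
member (suc (suc (suc zero))) true = 3₄ ∷ 2₄ ∷ []
member (suc (suc (suc (suc zero)))) false = 0₄ ∷ 2₄ ∷ []
member (suc (suc (suc (suc zero)))) true = 2₄ ∷ 2₄ ∷ []
member (suc (suc (suc (suc (suc zero))))) false = 1₄ ∷ 3₄ ∷ []
member (suc (suc (suc (suc (suc zero))))) true = 3₄ ∷ 3₄ ∷ []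
member (suc (suc (suc (suc (suc (suc zero)))))) false = 0₄ ∷ 3₄ ∷ []
member (suc (suc (suc (suc (suc (suc zero)))))) true = 2₄ ∷ 3₄ ∷ []
member (suc (suc (suc (suc (suc (suc (suc zero))))))) false = 1₄ ∷ 0₄ ∷ []
member (suc (suc (suc (suc (suc (suc (suc zero))))))) true = 3₄ ∷ 0₄ ∷ []

class : Vertex 2 → Fin 8
class (a ∷ c ∷ []) = if even a then double c else prev (double c)
  where
    double : Fin 4 → Fin 8
    double c = arc zero (2 * toℕ c)

twin : Vertex 2 → Bool
twin (0₄ ∷ _) = false
twin (1₄ ∷ _) = false
twin (2₄ ∷ _) = true
twin (3₄ ∷ _) = true

IsNeighbour : Vertex 2 → Vertex 2 → Set
IsNeighbour (a ∷ c ∷ []) y =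
  y ≡ inc4 a ∷ c ∷ [] ⊎ y ≡ dec4 a ∷ c ∷ [] ⊎ y ≡ inc4 a ∷ shift a c ∷ [] ⊎ y ≡ dec4 a ∷ shift a c ∷ []

neighbour? : ∀ x y → Dec (IsNeighbour x y)
neighbour? (a ∷ c ∷ []) y =
  (y ≟ᵛ _) ⊎-dec (y ≟ᵛ _) ⊎-dec (y ≟ᵛ _) ⊎-dec (y ≟ᵛ _)

neighbour⇒adj : ∀ {x y} → IsNeighbour x y → Adj x y
neighbour⇒adj {_ ∷ _ ∷ []} (inj₁ refl) = outer plus
neighbour⇒adj {_ ∷ _ ∷ []} (inj₂ (inj₁ refl)) = outer minus
neighbour⇒adj {_ ∷ _ ∷ []} (inj₂ (inj₂ (inj₁ refl))) = inner zero plus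
neighbour⇒adj {_ ∷ _ ∷ []} (inj₂ (inj₂ (inj₂ refl))) = inner zero minus

adj⇒neighbour : ∀ {x y} → Adj x y → IsNeighbour x y
adj⇒neighbour {_ ∷ _ ∷ []} (outer plus) = inj₁ refl
adj⇒neighbour {_ ∷ _ ∷ []} (outer minus) = inj₂ (inj₁ refl)
adj⇒neighbour {_ ∷ _ ∷ []} (inner zero plus) = inj₂ (inj₂ (inj₁ refl))
adj⇒neighbour {_ ∷ _ ∷ []} (inner zero minus) = inj₂ (inj₂ (inj₂ refl))

Beside : Fin 8 → Fin 8 → Set
Beside i j = j ≡ next i ⊎ j ≡ prev i

all-bool? : ∀ {P : Bool → Set} → (∀ b → Dec (P b)) → Dec (∀ b → P b)
all-bool? P? = map′ (λ (pf , pt) → λ { false → pf ; true → pt }) (λ h → h false , h true) (P? false ×-dec P? true)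

member-class : ∀ i t → class (member i t) ≡ i × twin (member i t) ≡ t
member-class = toWitness {a? = FinP.all? λ i → all-bool? λ t →
  (class (member i t) FinP.≟ i) ×-dec (twin (member i t) BoolP.≟ t)} _

class-member : ∀ a c → member (class (a ∷ c ∷ [])) (twin (a ∷ c ∷ [])) ≡ a ∷ c ∷ []
class-member = toWitness {a? = FinP.all? λ a → FinP.all? λ c →
  member (class (a ∷ c ∷ [])) (twin (a ∷ c ∷ [])) ≟ᵛ (a ∷ c ∷ [])} _

classes-joined : ∀ i t t' → IsNeighbour (member i t) (member (next i) t')
classes-joined = toWitness {a? = FinP.all? λ i → all-bool? λ t → all-bool? λ t' →
  neighbour? (member i t) (member (next i) t')} _

neighbours-beside : ∀ a c a' c' → IsNeighbour (a ∷ c ∷ []) (a' ∷ c' ∷ []) → Beside (class (a ∷ c ∷ [])) (class (a' ∷ c' ∷ []))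
neighbours-beside = toWitness {a? = FinP.all? λ a → FinP.all? λ c → FinP.all? λ a' → FinP.all? λ c' →
  neighbour? (a ∷ c ∷ []) (a' ∷ c' ∷ []) →-dec
    ((class (a' ∷ c' ∷ []) FinP.≟ next (class (a ∷ c ∷ []))) ⊎-dec (class (a' ∷ c' ∷ []) FinP.≟ prev (class (a ∷ c ∷ []))))} _

not-beside-self : ∀ i → ¬ Beside i i
not-beside-self = toWitness {a? = FinP.all? λ i → ¬? ((i FinP.≟ next i) ⊎-dec (i FinP.≟ prev i))} _

Far : Fin 8 → Fin 8 → Set
Far i j = i ≢ j × ¬ Beside i j

far-across : ∀ x → Far (prev x) (next x)
far-across = toWitness {a? = FinP.all? λ x →
  ¬? (prev x FinP.≟ next x) ×-dec ¬? ((next x FinP.≟ next (prev x)) ⊎-dec (next x FinP.≟ prev (prev x)))} _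

next-prev : ∀ x → next (prev x) ≡ x
next-prev = toWitness {a? = FinP.all? λ x → next (prev x) FinP.≟ x} _

arc-covers : ∀ d i → Σ (Fin 8) λ m → i ≡ arc d (suc (toℕ m))
arc-covers = toWitness {a? = FinP.all? λ d → FinP.all? λ i → FinP.any? λ m → i FinP.≟ arc d (suc (toℕ m))} _

arc-avoids : ∀ d (j : Fin 6) → arc d (2 + toℕ j) ≢ d × arc d (2 + toℕ j) ≢ next d
arc-avoids = toWitness {a? = FinP.all? λ d → FinP.all? λ j →
  ¬? (arc d (2 + toℕ j) FinP.≟ d) ×-dec ¬? (arc d (2 + toℕ j) FinP.≟ next d)} _

adj-beside : ∀ {x y : Vertex 2} → Adj x y → Beside (class x) (class y)
adj-beside {a ∷ c ∷ []} {a' ∷ c' ∷ []} e = neighbours-beside a c a' c' (adj⇒neighbour e)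

member-adj : ∀ i t t' → Adj (member i t) (member (next i) t')
member-adj i t t' = neighbour⇒adj (classes-joined i t t')

far-separated : ∀ {i j} t t' → Far i j → Separated (member i t) (member j t')
far-separated {i} {j} t t' (i≢j , not-beside) =
  (λ e → i≢j (trans (sym (proj₁ (member-class i t))) (trans (cong class e) (proj₁ (member-class j t'))))) ,
  λ e → not-beside (subst₂ Beside (proj₁ (member-class i t)) (proj₁ (member-class j t')) (adj-beside e))

twins-separated : ∀ i → Separated (member i false) (member i true)
twins-separated i =
  (λ e → false≢true (trans (sym (proj₂ (member-class i false))) (trans (cong twin e) (proj₂ (member-class i true))))) ,
  λ e → not-beside-self i (subst₂ Beside (proj₁ (member-class i false)) (proj₁ (member-class i true)) (adj-beside e))
  where false≢true : false ≢ true
        false≢true ()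

module _ (fs : List (Fault 2)) (few : length fs < 4) where

  private
    W : Vertex 2 → Vertex 2 → Set
    W = Walk (Survives fs)

    Dead Alive : Fin 8 → Set
    Dead i = Covered fs (member i false) × Covered fs (member i true)
    Alive i = Σ Bool λ t → Survives fs (member i t)

    alive-or-dead : ∀ i → Alive i ⊎ Dead i
    alive-or-dead i with covered? fs (member i false) | covered? fs (member i true)
    ... | no ok | _ = inj₁ (false , ok)
    ... | yes _ | no ok = inj₁ (true , ok)
    ... | yes c₀ | yes c₁ = inj₂ (c₀ , c₁)

    dead? : ∀ i → Dec (Dead i)
    dead? i = covered? fs (member i false) ×-dec covered? fs (member i true)

    -- two dead far classes would give four separated covered vertices
    no-far-deaths : ∀ {i j} → Far i j → Dead i → Dead j → ⊥
    no-far-deaths {i} {j} i-far-j (c₀ , c₁) (c₀' , c₁') =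
      <⇒≱ few (covering-bound fs _ separated (c₀ ∷ c₁ ∷ c₀' ∷ c₁' ∷ []))
      where
        separated : AllPairs Separated (member i false ∷ member i true ∷ member j false ∷ member j true ∷ [])
        separated = (twins-separated i ∷ far-separated false false i-far-j ∷ far-separated false true i-far-j ∷ [])
                  ∷ (far-separated true false i-far-j ∷ far-separated true true i-far-j ∷ [])
                  ∷ (twins-separated j ∷ []) ∷ [] ∷ []

    dead-pair : Σ (Fin 8) λ d → ∀ i → Dead i → i ≡ d ⊎ i ≡ next d
    dead-pair with FinP.any? dead?
    ... | no none = zero , λ i dead → ⊥-elim (none (i , dead))
    ... | yes (x , dead-x) with dead? (next x)
    ...   | yes dead-next = x , only
      where
        only : ∀ i → Dead i → i ≡ x ⊎ i ≡ next x
        only i dead with i FinP.≟ x | i FinP.≟ next x | i FinP.≟ prev x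
        ... | yes e | _ | _ = inj₁ e
        ... | no _ | yes e | _ = inj₂ e
        ... | no _ | no _ | yes refl = ⊥-elim (no-far-deaths (far-across x) dead dead-next)
        ... | no i≢x | no i≢next | no i≢prev =
          ⊥-elim (no-far-deaths ((λ e → i≢x (sym e)) , [ i≢next , i≢prev ]′) dead-x dead)
    ...   | no alive-next = prev x , only
      where
        only : ∀ i → Dead i → i ≡ prev x ⊎ i ≡ next (prev x)
        only i dead with i FinP.≟ prev x | i FinP.≟ x | i FinP.≟ next x
        ... | yes e | _ | _ = inj₁ e
        ... | no _ | yes e | _ = inj₂ (trans e (sym (next-prev x)))
        ... | no _ | no _ | yes refl = ⊥-elim (alive-next dead)
        ... | no i≢prev | no i≢x | no i≢next =
          ⊥-elim (no-far-deaths ((λ e → i≢x (sym e)) , [ i≢next , i≢prev ]′) dead-x dead)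

    module Route (d : Fin 8) (dead-near : ∀ i → Dead i → i ≡ d ⊎ i ≡ next d) where

      alive-arc : ∀ (j : Fin 6) → Alive (arc d (2 + toℕ j))
      alive-arc j with alive-or-dead (arc d (2 + toℕ j))
      ... | inj₁ alive = alive
      ... | inj₂ dead = ⊥-elim ([ proj₁ (arc-avoids d j) , proj₂ (arc-avoids d j) ]′ (dead-near _ dead))

      record Reaches (u : Vertex 2) (i : Fin 8) : Set where
        constructor reached
        field
          which : Bool
          survives : Survives fs (member i which)
          walk : W u (member i which)

      forward : ∀ {u i} → Reaches u i → Alive (next i) → Reaches u (next i)
      forward {i = i} (reached t ok w) (t' , ok') = reached t' ok' (w ++ʷ edge-walk ok (member-adj i t t') ok')

      backward : ∀ {u i} → Reaches u (next i) → Alive i → Reaches u i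
      backward {i = i} (reached t ok w) (t' , ok') = reached t' ok' (w ++ʷ edge-walk ok (adj-sym (member-adj i t' t)) ok')

      to-arc5 : ∀ {u} (m : Fin 8) → Reaches u (arc d (suc (toℕ m))) → Reaches u (arc d 5)
      to-arc5 zero r =
        forward (forward (forward (forward r (alive-arc (# 0))) (alive-arc (# 1))) (alive-arc (# 2))) (alive-arc (# 3))
      to-arc5 (suc zero) r = forward (forward (forward r (alive-arc (# 1))) (alive-arc (# 2))) (alive-arc (# 3))
      to-arc5 (suc (suc zero)) r = forward (forward r (alive-arc (# 2))) (alive-arc (# 3))
      to-arc5 (suc (suc (suc zero))) r = forward r (alive-arc (# 3))
      to-arc5 (suc (suc (suc (suc zero)))) r = r
      to-arc5 (suc (suc (suc (suc (suc zero))))) r = backward r (alive-arc (# 3))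
      to-arc5 (suc (suc (suc (suc (suc (suc zero)))))) r = backward (backward r (alive-arc (# 4))) (alive-arc (# 3))
      to-arc5 (suc (suc (suc (suc (suc (suc (suc zero))))))) r =
        backward (backward (backward r (alive-arc (# 5))) (alive-arc (# 4))) (alive-arc (# 3))

      hub-twin : Bool
      hub-twin = proj₁ (alive-arc (# 2))

      hub : Vertex 2
      hub = member (arc d 4) hub-twin

      start : ∀ u → Survives fs u → Reaches u (class u)
      start u@(a ∷ c ∷ []) ok =
        reached (twin u) (subst (Survives fs) (sym (class-member a c)) ok) (subst (W u) (sym (class-member a c)) (here ok))

      to-hub : ∀ u → Survives fs u → W u hub
      to-hub u ok with arc-covers d (class u)
      ... | m , on-arc with to-arc5 m (subst (Reaches u) on-arc (start u ok))
      ...   | reached t ok₅ w = w ++ʷ edge-walk ok₅ (adj-sym (member-adj (arc d 4) hub-twin t)) (proj₂ (alive-arc (# 2)))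

      connected : Connected (Survives fs)
      connected = connected-via-hub hub (proj₂ (alive-arc (# 2))) to-hub

  base-case : Connected (Survives fs)
  base-case = Route.connected (proj₁ dead-pair) (proj₂ dead-pair)

fault-tolerance : ∀ k (fs : List (Fault (suc (suc k)))) → length fs < 2 * suc (suc k) → Connected (Survives fs)
fault-tolerance zero = base-case
fault-tolerance (suc k) = inductive-step (fault-tolerance k)

module _ {n : ℕ} (F1 : List (Vertex n)) (F2 : List (Edge n)) where

  faults : List (Fault n)
  faults = map inj₁ F1 ++ map inj₂ F2

  faults-length : length faults ≡ length F1 + length F2
  faults-length = trans (ListP.length-++ (map inj₁ F1)) (cong₂ _+_ (ListP.length-map inj₁ F1) (ListP.length-map inj₂ F2))

  faults-covered⁺ : ∀ {v} → InFaults F1 F2 v → Covered faults v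
  faults-covered⁺ (inj₁ v∈F1) = AnyP.++⁺ˡ (AnyP.map⁺ v∈F1)
  faults-covered⁺ (inj₂ v∈F2) = AnyP.++⁺ʳ (map inj₁ F1) (AnyP.map⁺ v∈F2)

  faults-covered⁻ : ∀ {v} → Covered faults v → InFaults F1 F2 v
  faults-covered⁻ c with AnyP.++⁻ (map inj₁ F1) c
  ... | inj₁ c₁ = inj₁ (AnyP.map⁻ c₁)
  ... | inj₂ c₂ = inj₂ (AnyP.map⁻ c₂)

  remaining-connected : Connected (Survives faults) → Connected (Remaining F1 F2)
  remaining-connected ((w , ok) , joined) = (w , ok ∘ faults-covered⁺) , λ u v ok-u ok-v →
    walk-map (_∘ faults-covered⁺) (joined u v (ok-u ∘ faults-covered⁻) (ok-v ∘ faults-covered⁻))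

lemma10 : (n : ℕ) → 2 ≤ n → (F1 : List (Vertex n)) → (F2 : List (Edge n)) →
    length F1 + length F2 ≤ 2 * n ∸ 1 →
    Connected (Remaining F1 F2)
lemma10 (suc (suc k)) (s≤s (s≤s _)) F1 F2 bound =
  remaining-connected F1 F2 (fault-tolerance k (faults F1 F2) few)
  where
    few : length (faults F1 F2) < 2 * suc (suc k)
    few = subst (_< 2 * suc (suc k)) (sym (faults-length F1 F2)) (s≤s bound)
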